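{- Let $(A,\mathbf{C}^t)$ be a tangled closure algebra with induced closure operator $\mathbf{C}$, and let $\varGamma\subseteq A$ be finite and non-empty. Define $f_\varGamma:A\to A$ by $f_\varGamma(a)=\bigwedge_{\gamma\in\varGamma}\mathbf{C}(\gamma\land a)$. Then $\mathbf{C}^t\varGamma=\bigwedge_{\gamma\in\varGamma}\mathbf{C}(\gamma\land\mathbf{C}^t\varGamma)$, and $\mathbf{C}^t\varGamma$ is the greatest fixed point of $f_\varGamma$ and also the greatest post-fixed point of $f_\varGamma$ (i.e. the greatest $a$ with $a\leq f_\varGamma(a)$).
   Context: Let $A$ be a Boolean algebra with operations $\land,\lor,-,0,1$; write $a\Rightarrow b=-a\lor b$. A closure operator on $A$ is a map $\mathbf{C}:A\to A$ with $\mathbf{C}(a\lor b)=\mathbf{C}a\lor\mathbf{C}b$, $\mathbf{C}0=0$, $a\leq\mathbf{C}a=\mathbf{C}\mathbf{C}a$; its dual interior operator is $\mathbf{I}a=-\mathbf{C}-a$. Let $\mathcal{P}_{fin}A$ be the set of finite non-empty subsets of $A$. Given $\mathbf{C}^t:\mathcal{P}_{fin}A\to A$, the induced unary map is $\mathbf{C}a=\mathbf{C}^t\{a\}$ and $\mathbf{I}a=-\mathbf{C}^t\{ -a\}$. $(A,\mathbf{C}^t)$ is a tangled closure algebra if the induced $\mathbf{C}$ is a closure operator and for all $\varGamma\in\mathcal{P}_{fin}A$ and $a\in A$: (Fix) $\mathbf{C}^t\varGamma\leq\bigwedge_{\gamma\in\varGamma}\mathbf{C}(\gamma\land\mathbf{C}^t\varGamma)$;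 (Ind) $\mathbf{I}\big(a\Rightarrow\bigwedge_{\gamma\in\varGamma}\mathbf{C}(\gamma\land a)\big)\land a\leq\mathbf{C}^t\varGamma$. -}

module Defs where

open import Level using (Level; _⊔_; suc)
open import Data.Product using (_×_)
open import Data.List.NonEmpty using (List⁺; [_]; toList; foldr₁; map)
open import Algebra.Lattice.Bundles using (BooleanAlgebra)
import Data.List.Membership.Setoid as Mem

module _ {c ℓ : Level} (B : BooleanAlgebra c ℓ) where
  open BooleanAlgebra B
  open Mem setoid using (_∈_)

  _≤_ : Carrier → Carrier → Set ℓ
  a ≤ b = (a ∧ b) ≈ a

  _⇒_ : Carrier → Carrier → Carrier
  a ⇒ b = (¬ a) ∨ b

  ⋀ : List⁺ Carrier → (Carrier → Carrier) → Carrier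
  ⋀ Γ g = foldr₁ _∧_ (map g Γ)

  -- Finite non-empty subsets of A are represented by non-empty lists;
  -- two lists denote the same subset iff they have the same elements (up to ≈).
  SameSet : List⁺ Carrier → List⁺ Carrier → Set (c ⊔ ℓ)
  SameSet Γ Δ = (∀ x → x ∈ toList Γ → x ∈ toList Δ) × (∀ x → x ∈ toList Δ → x ∈ toList Γ)

  record IsTangledClosureAlgebra (Ct : List⁺ Carrier → Carrier) : Set (c ⊔ ℓ) where
    C : Carrier → Carrier
    C a = Ct [ a ]
    I : Carrier → Carrier
    I a = ¬ (Ct [ ¬ a ])
    field
      Ct-cong   : ∀ Γ Δ → SameSet Γ Δ → Ct Γ ≈ Ct Δ
      C-∨       : ∀ a b → C (a ∨ b) ≈ (C a ∨ C b)
      C-⊥       : C ⊥ ≈ ⊥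
      C-incr    : ∀ a → a ≤ C a
      C-idem    : ∀ a → C a ≈ C (C a)
      Fix       : ∀ Γ → Ct Γ ≤ ⋀ Γ (λ γ → C (γ ∧ Ct Γ))
      Ind       : ∀ Γ a → (I (a ⇒ ⋀ Γ (λ γ → C (γ ∧ a))) ∧ a) ≤ Ct Γ

record TangledClosureAlgebra (c ℓ : Level) : Set (suc (c ⊔ ℓ)) where
  field
    boolAlg : BooleanAlgebra c ℓ
    Ct      : List⁺ (BooleanAlgebra.Carrier boolAlg) → BooleanAlgebra.Carrier boolAlg
    isTCA   : IsTangledClosureAlgebra boolAlg Ct
  open BooleanAlgebra boolAlg public
  open IsTangledClosureAlgebra isTCA public

  f : List⁺ Carrier → Carrier → Carrier
  f Γ a = ⋀ boolAlg Γ (λ γ → C (γ ∧ a))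

  _≤A_ : Carrier → Carrier → Set ℓ
  _≤A_ = _≤_ boolAlg

-- Ind, applied to a post-fixed point a of f_Γ, has antecedent I(a ⇒ f_Γ a) = I ⊤ = ⊤, so it
-- says that every post-fixed point lies below Ct Γ. Fix says that Ct Γ is itself a post-fixed
-- point; as f_Γ is monotone, so is f_Γ (Ct Γ), which therefore lies below Ct Γ, making Ct Γ a
-- fixed point, and since fixed points are post-fixed points it is the greatest one.
module Submission where

open import Defs hiding (_≤_)
open import Level using (Level)
open import Data.Product using (_×_; _,_)
open import Data.List.NonEmpty using (List⁺; _∷_; [_]; toList)
open import Data.List using ([]; _∷_)
open import Data.List.Relation.Unary.Any using (here; there)
open import Algebra.Lattice.Bundles using (BooleanAlgebra)
import Algebra.Lattice.Properties.BooleanAlgebra as BooleanAlgebraProperties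
import Data.List.Membership.Setoid as Membership
import Relation.Binary.Lattice as OrderTheoretic
import Relation.Binary.Lattice.Properties.JoinSemilattice as JoinSemilatticeProperties
import Relation.Binary.Lattice.Properties.MeetSemilattice as MeetSemilatticeProperties

-- The order of Defs, a ∧ b ≈ a, is the library's natural order _≤_ (a ≈ a ∧ b) up to sym.
module BooleanOrder {c ℓ : Level} (B : BooleanAlgebra c ℓ) where
  open BooleanAlgebra B
  open BooleanAlgebraProperties B using (∨-∧-orderTheoreticLattice; ∨-zeroˡ)
  open OrderTheoretic.Lattice ∨-∧-orderTheoreticLattice public
    using (_≤_; x≤x∨y; ≤-respˡ-≈; ≤-respʳ-≈)
    renaming (refl to ≤-refl; reflexive to ≤-reflexive; antisym to ≤-antisym)
  open JoinSemilatticeProperties (OrderTheoretic.Lattice.joinSemilattice ∨-∧-orderTheoreticLattice)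
    public using (x≤y⇒x∨y≈y)
  open MeetSemilatticeProperties (OrderTheoretic.Lattice.meetSemilattice ∨-∧-orderTheoreticLattice)
    public using (∧-monotonic)
  open import Relation.Binary.Reasoning.Setoid setoid

  ∨-preserving⇒monotone : (h : Carrier → Carrier) → (∀ {a b} → a ≈ b → h a ≈ h b) →
                           (∀ a b → h (a ∨ b) ≈ h a ∨ h b) → ∀ {a b} → a ≤ b → h a ≤ h b
  ∨-preserving⇒monotone h h-cong h-∨ {a} {b} a≤b =
    ≤-respʳ-≈ (sym (trans (h-cong (sym (x≤y⇒x∨y≈y a≤b))) (h-∨ a b))) (x≤x∨y (h a) (h b))

  ≤⇒⇒≈⊤ : ∀ {a b} → a ≤ b → _⇒_ B a b ≈ ⊤
  ≤⇒⇒≈⊤ {a} {b} a≤b = begin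
    ¬ a ∨ b        ≈⟨ ∨-cong refl (x≤y⇒x∨y≈y a≤b) ⟨
    ¬ a ∨ (a ∨ b)  ≈⟨ ∨-assoc (¬ a) a b ⟨
    (¬ a ∨ a) ∨ b  ≈⟨ ∨-cong (∨-complementˡ a) refl ⟩
    ⊤ ∨ b          ≈⟨ ∨-zeroˡ b ⟩
    ⊤              ∎

  ⋀-monotone : ∀ Γ {g h : Carrier → Carrier} → (∀ x → g x ≤ h x) → ⋀ B Γ g ≤ ⋀ B Γ h
  ⋀-monotone (x ∷ xs) {g} {h} g≤h = go x xs
    where
    go : ∀ x xs → ⋀ B (x ∷ xs) g ≤ ⋀ B (x ∷ xs) h
    go x []       = g≤h x
    go x (y ∷ ys) = ∧-monotonic (g≤h x) (go y ys)

module TangledClosure {c ℓ : Level} (T : TangledClosureAlgebra c ℓ) where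
  open TangledClosureAlgebra T
  open BooleanAlgebraProperties boolAlg using (¬⊤≈⊥; ¬⊥≈⊤; ∧-identityˡ)
  open BooleanOrder boolAlg
  open Membership setoid using (_∈_)
  open import Relation.Binary.Reasoning.Setoid setoid

  C-cong : ∀ {a b} → a ≈ b → C a ≈ C b
  C-cong {a} {b} a≈b = Ct-cong [ a ] [ b ] (transport a≈b , transport (sym a≈b))
    where
    transport : ∀ {u v} → u ≈ v → ∀ x → x ∈ toList [ u ] → x ∈ toList [ v ]
    transport u≈v x (here x≈u) = here (trans x≈u u≈v)
    transport u≈v x (there ())

  C-monotone : ∀ {a b} → a ≤ b → C a ≤ C b
  C-monotone = ∨-preserving⇒monotone C C-cong C-∨

  f-monotone : ∀ Γ {a b} → a ≤ b → f Γ a ≤ f Γ b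
  f-monotone Γ a≤b = ⋀-monotone Γ (λ γ → C-monotone (∧-monotonic ≤-refl a≤b))

  I-cong : ∀ {a b} → a ≈ b → I a ≈ I b
  I-cong a≈b = ¬-cong (C-cong (¬-cong a≈b))

  I⊤≈⊤ : I ⊤ ≈ ⊤
  I⊤≈⊤ = trans (¬-cong (trans (C-cong ¬⊤≈⊥) C-⊥)) ¬⊥≈⊤

  postfixed⇒≤Ct : ∀ Γ {a} → a ≤ f Γ a → a ≤ Ct Γ
  postfixed⇒≤Ct Γ {a} a≤fa = ≤-respˡ-≈ trivial-antecedent (sym (Ind Γ a))
    where
    trivial-antecedent : I (_⇒_ boolAlg a (f Γ a)) ∧ a ≈ a
    trivial-antecedent = begin
      I (_⇒_ boolAlg a (f Γ a)) ∧ a  ≈⟨ ∧-cong (I-cong (≤⇒⇒≈⊤ a≤fa)) refl ⟩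
      I ⊤ ∧ a                       ≈⟨ ∧-cong I⊤≈⊤ refl ⟩
      ⊤ ∧ a                         ≈⟨ ∧-identityˡ a ⟩
      a                             ∎

  Ct-fixed : ∀ Γ → Ct Γ ≈ f Γ (Ct Γ)
  Ct-fixed Γ = ≤-antisym Ct≤fCt (postfixed⇒≤Ct Γ (f-monotone Γ Ct≤fCt))
    where
    Ct≤fCt : Ct Γ ≤ f Γ (Ct Γ)
    Ct≤fCt = sym (Fix Γ)

  fixed⇒≤Ct : ∀ Γ {a} → a ≈ f Γ a → a ≤ Ct Γ
  fixed⇒≤Ct Γ a≈fa = postfixed⇒≤Ct Γ (≤-reflexive a≈fa)

corollary2p2 : {c ℓ : Level} (T : TangledClosureAlgebra c ℓ) →
    let open TangledClosureAlgebra T in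
    (Γ : List⁺ Carrier) →
    (Ct Γ ≈ f Γ (Ct Γ))
    × ((Ct Γ ≈ f Γ (Ct Γ)) × (∀ a → a ≈ f Γ a → a ≤A Ct Γ))
    × ((Ct Γ ≤A f Γ (Ct Γ)) × (∀ a → a ≤A f Γ a → a ≤A Ct Γ))
corollary2p2 T Γ =
  Ct-fixed Γ ,
  (Ct-fixed Γ , λ _ a≈fa → sym (fixed⇒≤Ct Γ a≈fa)) ,
  (Fix Γ , λ _ a≤fa → sym (postfixed⇒≤Ct Γ (sym a≤fa)))
  where
  open TangledClosureAlgebra T using (Fix; sym)
  open TangledClosure T
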